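{- Let $G\neq1$ be a finite abelian group, $R,L\subseteq G$ with $R=R^{ -1}$, $L=L^{ -1}$, $1\notin R\cup L$, $|L|\le|R|\le2$, and let $\Gamma=\mathrm{SC}(G;R,L,\{1\})$ be connected with $A=\mathrm{Aut}(\Gamma)$. Suppose $\Gamma$ is intransitive and $R\cap L=\emptyset$. Let $\Omega=\{\{(g,1),(g,2)\}\mid g\in G\}$ and let $\Gamma_\Omega$ be the quotient graph of $\Gamma$ with respect to $\Omega$. Then $A\le\mathrm{Aut}(\Gamma_\Omega)$ (i.e. $A$ acts faithfully on $\Omega$ as a group of automorphisms of $\Gamma_\Omega$), and $\Gamma_\Omega$ is a Cayley graph of $R_G$ with respect to $S=\{\rho_r,\rho_l\mid r\in R,\ l\in L\}$, of valency $|R|+|L|$. In particular, if $\Gamma_\Omega$ is a normal Cayley graph of $R_G$, then $\Gamma$ is a normal semi-Cayley graph of $R_G$.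
   Context: $\mathrm{SC}(G;R,L,\{1\})$ is the graph with vertex set $G\times\{1,2\}$ and edges $\{(x,1),(y,1)\}$ for $yx^{ -1}\in R$, $\{(x,2),(y,2)\}$ for $yx^{ -1}\in L$, and $\{(x,1),(x,2)\}$ for $x\in G$. $R_G=\{\rho_g\mid g\in G\}$ where $(x,i)^{\rho_g}=(xg,i)$; $\Gamma$ is normal (a normal semi-Cayley graph of $R_G$) if $R_G\trianglelefteq\mathrm{Aut}(\Gamma)$. The quotient graph $\Gamma_\Omega$ has vertex set $\Omega$, two blocks being adjacent if some edge of $\Gamma$ joins a vertex of one to a vertex of the other; $R_G$ acts on $\Omega$ naturally. A Cayley graph of a group $H$ is normal if (the regular copy of) $H$ is normal in its automorphism group. Intransitive means $\mathrm{Aut}(\Gamma)$ is not vertex-transitive. -}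

module Defs where

open import Level using (0ℓ)
open import Algebra.Structures using (IsAbelianGroup)
open import Data.Nat using (ℕ; _+_)
open import Data.Fin using (Fin; zero; suc)
open import Data.Product using (Σ; ∃; _×_; _,_; proj₁; proj₂)
open import Data.Sum using (_⊎_)
open import Data.List using (List; length; _++_)
open import Data.List.Membership.Propositional using (_∈_)
open import Data.List.Relation.Unary.Unique.Propositional using (Unique)
open import Relation.Binary.PropositionalEquality using (_≡_; _≢_)
open import Relation.Nullary using (¬_)
open import Function.Bundles using (_↔_; Inverse; _⇔_)
open import Relation.Binary.Construct.Closure.ReflexiveTransitive using (Star)

record FinAbGroup : Set₁ where
  infixl 7 _∙_
  infix 8 _⁻¹
  field
    Carrier        : Set
    _∙_            : Carrier → Carrier → Carrier
    ε              : Carrier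
    _⁻¹            : Carrier → Carrier
    isAbelianGroup : IsAbelianGroup _≡_ _∙_ ε _⁻¹
    size           : ℕ
    enum           : Carrier ↔ Fin size

module Graph {V : Set} (E : V → V → Set) where

  record Automorphism : Set where
    field
      perm      : V ↔ V
      preserves : ∀ u v → E u v ⇔ E (Inverse.to perm u) (Inverse.to perm v)

  app : Automorphism → V → V
  app σ = Inverse.to (Automorphism.perm σ)

  app⁻¹ : Automorphism → V → V
  app⁻¹ σ = Inverse.from (Automorphism.perm σ)

  Connected : Set
  Connected = ∀ u v → Star E u v

  VertexTransitive : Set
  VertexTransitive = ∀ u v → Σ Automorphism λ σ → app σ u ≡ v

  NormalIn : {H : Set} → (H → V → V) → Set
  NormalIn {H} act =
    ∀ (σ : Automorphism) (g : H) → Σ H λ h →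
      ∀ v → app σ (act g (app⁻¹ σ v)) ≡ act h v

-- The semi-Cayley graph SC(G;R,L,{1}) and related objects.
-- Layer 1 is `zero`, layer 2 is `suc zero`.

module SC (G : FinAbGroup) (R L : List (FinAbGroup.Carrier G)) where
  open FinAbGroup G

  V : Set
  V = Carrier × Fin 2

  Adj : V → V → Set
  Adj (x , zero)     (y , zero)     = y ∙ x ⁻¹ ∈ R
  Adj (x , suc zero) (y , suc zero) = y ∙ x ⁻¹ ∈ L
  Adj (x , zero)     (y , suc zero) = x ≡ y
  Adj (x , suc zero) (y , zero)     = x ≡ y

  ρ : Carrier → V → V
  ρ g (x , i) = (x ∙ g , i)

  module Γ = Graph Adj

  NormalSemiCayley : Set
  NormalSemiCayley = Γ.NormalIn ρ

  -- Quotient graph Γ_Ω, with the block {(g,1),(g,2)} identified with g: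
  -- distinct blocks adjacent iff some edge joins them.
  QAdj : Carrier → Carrier → Set
  QAdj g h = g ≢ h × ∃ λ i → ∃ λ j → Adj (g , i) (h , j)

  module ΓΩ = Graph QAdj

  Induces : Γ.Automorphism → ΓΩ.Automorphism → Set
  Induces σ τ = ∀ g i → proj₁ (Γ.app σ (g , i)) ≡ ΓΩ.app τ g

  -- A ≤ Aut(Γ_Ω): every automorphism of Γ induces an automorphism of
  -- Γ_Ω, and the induced action is faithful.
  AutEmbeds : Set
  AutEmbeds =
    (∀ σ → Σ ΓΩ.Automorphism λ τ → Induces σ τ)
    × (∀ σ σ' τ → Induces σ τ → Induces σ' τ → ∀ v → Γ.app σ v ≡ Γ.app σ' v)

  ρΩ : Carrier → Carrier → Carrier
  ρΩ g x = x ∙ g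

  -- Cayley graph of R_G w.r.t. S = {ρ_s | s ∈ R ∪ L} (ρ_g ↔ block g):
  -- ρ_g ~ ρ_h iff ρ_h ρ_g⁻¹ = ρ_{h g⁻¹} ∈ S
  CayAdj : Carrier → Carrier → Set
  CayAdj g h = h ∙ g ⁻¹ ∈ (R ++ L)

  IsCayleyS : Set
  IsCayleyS = ∀ g h → QAdj g h ⇔ CayAdj g h

  Valency : ℕ → Set
  Valency k = ∀ g → Σ (List Carrier) λ N →
    Unique N × (∀ h → (h ∈ N) ⇔ QAdj g h) × length N ≡ k

  NormalCayleyΩ : Set
  NormalCayleyΩ = ΓΩ.NormalIn ρΩ

  Conclusion : Set
  Conclusion = AutEmbeds × IsCayleyS × Valency (length R + length L)
               × (NormalCayleyΩ → NormalSemiCayley)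

module Submission where

-- An automorphism σ of Γ that maps some (x,1) to some (y,2) would, together with
-- the right translations ρ_g (transitive on each layer), make Γ vertex-transitive.
-- So in the intransitive case every automorphism preserves the two layers, and as
-- the only edges between the layers are the spokes (x,1)–(x,2), it maps blocks to
-- blocks: σ (x , i) = (τ x , i). The induced permutation τ is an automorphism of
-- Γ_Ω that determines σ, and σ ρ_g σ⁻¹ acts on each layer as τ ρ_g τ⁻¹ does on Ω.
-- Distinct blocks g, h are joined only by edges inside a layer, i.e. exactly when
-- h g⁻¹ ∈ R ∪ L; disjointness of R and L then gives valency |R| + |L|.

open import Defs
open import Level using (0ℓ)
open import Data.Nat using (_+_; _≤_)
open import Data.Fin using (zero; suc)
open import Data.Product using (Σ; ∃; _,_; proj₁; proj₂)
open import Data.Sum using (inj₁; inj₂)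
open import Data.Empty using (⊥-elim)
open import Data.List using (List; length; _++_; map)
open import Data.List.Properties using (length-map; length-++)
open import Data.List.Membership.Propositional using (_∈_)
open import Data.List.Membership.Propositional.Properties
  using (∈-map⁺; ∈-map⁻; ∈-++⁺ˡ; ∈-++⁺ʳ; ∈-++⁻)
open import Data.List.Relation.Unary.Unique.Propositional using (Unique)
import Data.List.Relation.Unary.Unique.Propositional.Properties as Unique
open import Relation.Binary.PropositionalEquality
  using (_≡_; _≢_; refl; sym; trans; cong; cong₂; subst; subst₂; module ≡-Reasoning)
open import Relation.Nullary using (¬_)
open import Function.Bundles using (Inverse; _⇔_; mk↔ₛ′; mk⇔; Equivalence)
open import Algebra.Bundles using (AbelianGroup; Group)
import Algebra.Properties.AbelianGroup as AbelianGroupProperties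

module AutomorphismGroup {V : Set} (E : V → V → Set) where
  open Graph E

  app-app⁻¹ : ∀ σ v → app σ (app⁻¹ σ v) ≡ v
  app-app⁻¹ σ = Inverse.strictlyInverseˡ (Automorphism.perm σ)

  app⁻¹-app : ∀ σ v → app⁻¹ σ (app σ v) ≡ v
  app⁻¹-app σ = Inverse.strictlyInverseʳ (Automorphism.perm σ)

  preserves⁺ : ∀ σ {u v} → E u v → E (app σ u) (app σ v)
  preserves⁺ σ {u} {v} = Equivalence.to (Automorphism.preserves σ u v)

  preserves⁻ : ∀ σ {u v} → E (app σ u) (app σ v) → E u v
  preserves⁻ σ {u} {v} = Equivalence.from (Automorphism.preserves σ u v)

  infixr 9 _∘ᴬ_
  _∘ᴬ_ : Automorphism → Automorphism → Automorphism
  τ ∘ᴬ σ = record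
    { perm      = mk↔ₛ′ (λ v → app τ (app σ v)) (λ v → app⁻¹ σ (app⁻¹ τ v))
                    (λ v → trans (cong (app τ) (app-app⁻¹ σ _)) (app-app⁻¹ τ v))
                    (λ v → trans (cong (app⁻¹ σ) (app⁻¹-app τ _)) (app⁻¹-app σ v))
    ; preserves = λ u v → mk⇔ (λ e → preserves⁺ τ (preserves⁺ σ e))
                              (λ e → preserves⁻ σ (preserves⁻ τ e))
    }

  infix 10 _⁻¹ᴬ
  _⁻¹ᴬ : Automorphism → Automorphism
  σ ⁻¹ᴬ = record
    { perm      = mk↔ₛ′ (app⁻¹ σ) (app σ) (app⁻¹-app σ) (app-app⁻¹ σ)
    ; preserves = λ u v → mk⇔
        (λ e → preserves⁻ σ (subst₂ E (sym (app-app⁻¹ σ u)) (sym (app-app⁻¹ σ v)) e))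
        (λ e → subst₂ E (app-app⁻¹ σ u) (app-app⁻¹ σ v) (preserves⁺ σ e))
    }

module GroupProperties (G : FinAbGroup) where
  open FinAbGroup G

  abelianGroup : AbelianGroup 0ℓ 0ℓ
  abelianGroup = record
    { Carrier = Carrier ; _≈_ = _≡_ ; _∙_ = _∙_ ; ε = ε ; _⁻¹ = _⁻¹
    ; isAbelianGroup = isAbelianGroup }

  open AbelianGroup abelianGroup public using (group; assoc; comm; inverseʳ)
  open Group group public using (_//_; _\\_)
  open AbelianGroupProperties abelianGroup public
    using (//-rightDividesˡ; //-rightDividesʳ; \\-leftDividesˡ; ∙-cancelʳ; ⁻¹-∙-comm)
  open ≡-Reasoning

  //-∙-cancelʳ : ∀ y x g → (y ∙ g) // (x ∙ g) ≡ y // x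
  //-∙-cancelʳ y x g = begin
    (y ∙ g) ∙ (x ∙ g) ⁻¹     ≡⟨ cong ((y ∙ g) ∙_) (sym (⁻¹-∙-comm x g)) ⟩
    (y ∙ g) ∙ (x ⁻¹ ∙ g ⁻¹)  ≡⟨ assoc y g _ ⟩
    y ∙ (g ∙ (x ⁻¹ ∙ g ⁻¹))  ≡⟨ cong (λ k → y ∙ (g ∙ k)) (comm (x ⁻¹) (g ⁻¹)) ⟩
    y ∙ (g ∙ (g ⁻¹ ∙ x ⁻¹))  ≡⟨ cong (y ∙_) (\\-leftDividesˡ g (x ⁻¹)) ⟩
    y ∙ x ⁻¹                 ∎

  ∈-map-∙ʳ : ∀ {g h} (S : List Carrier) → h ∈ map (_∙ g) S ⇔ h // g ∈ S
  ∈-map-∙ʳ {g} {h} S = mk⇔ to from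
    where
    to : h ∈ map (_∙ g) S → h // g ∈ S
    to m with ∈-map⁻ (_∙ g) m
    ... | s , s∈S , refl = subst (_∈ S) (sym (//-rightDividesʳ g s)) s∈S
    from : h // g ∈ S → h ∈ map (_∙ g) S
    from m = subst (_∈ map (_∙ g) S) (//-rightDividesˡ g h) (∈-map⁺ (_∙ g) m)

  //∈⇒≢ : ∀ {g h} {S : List Carrier} → ¬ (ε ∈ S) → h // g ∈ S → g ≢ h
  //∈⇒≢ {S = S} ε∉S m refl = ε∉S (subst (_∈ S) (inverseʳ _) m)

module SemiCayley (G : FinAbGroup) (R L : List (FinAbGroup.Carrier G)) where
  open FinAbGroup G
  open GroupProperties G
  open SC G R L
  open Graph Adj
  open AutomorphismGroup Adj
  open ≡-Reasoning

  ρ-automorphism : Carrier → Automorphism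
  ρ-automorphism g = record
    { perm      = mk↔ₛ′ (ρ g) (ρ (g ⁻¹))
                    (λ { (x , i) → cong (_, i) (//-rightDividesˡ g x) })
                    (λ { (x , i) → cong (_, i) (//-rightDividesʳ g x) })
    ; preserves = ρ-preserves
    }
    where
    ρ-preserves : ∀ u v → Adj u v ⇔ Adj (ρ g u) (ρ g v)
    ρ-preserves (x , zero)     (y , zero)     =
      mk⇔ (subst (_∈ R) (sym (//-∙-cancelʳ y x g))) (subst (_∈ R) (//-∙-cancelʳ y x g))
    ρ-preserves (x , suc zero) (y , suc zero) =
      mk⇔ (subst (_∈ L) (sym (//-∙-cancelʳ y x g))) (subst (_∈ L) (//-∙-cancelʳ y x g))
    ρ-preserves (x , zero)     (y , suc zero) = mk⇔ (cong (_∙ g)) (∙-cancelʳ g x y)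
    ρ-preserves (x , suc zero) (y , zero)     = mk⇔ (cong (_∙ g)) (∙-cancelʳ g x y)

  ρ-\\ : ∀ a b i → app (ρ-automorphism (a \\ b)) (a , i) ≡ (b , i)
  ρ-\\ a b i = cong (_, i) (\\-leftDividesˡ a b)

  layerSwap⇒vertexTransitive : ∀ σ {x y} → app σ (x , zero) ≡ (y , suc zero) → VertexTransitive
  layerSwap⇒vertexTransitive σ {x} {y} σx≡y = transitive
    where
    swap : ∀ a b → Σ Automorphism λ τ → app τ (a , zero) ≡ (b , suc zero)
    swap a b = ρ-automorphism (y \\ b) ∘ᴬ σ ∘ᴬ ρ-automorphism (a \\ x)
             , (begin
                 app (ρ-automorphism (y \\ b)) (app σ (app (ρ-automorphism (a \\ x)) (a , zero)))
                   ≡⟨ cong (λ v → app (ρ-automorphism (y \\ b)) (app σ v)) (ρ-\\ a x zero) ⟩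
                 app (ρ-automorphism (y \\ b)) (app σ (x , zero))
                   ≡⟨ cong (app (ρ-automorphism (y \\ b))) σx≡y ⟩
                 app (ρ-automorphism (y \\ b)) (y , suc zero)
                   ≡⟨ ρ-\\ y b (suc zero) ⟩
                 (b , suc zero) ∎)
    transitive : VertexTransitive
    transitive (a , zero)     (b , zero)     = ρ-automorphism (a \\ b) , ρ-\\ a b zero
    transitive (a , suc zero) (b , suc zero) = ρ-automorphism (a \\ b) , ρ-\\ a b (suc zero)
    transitive (a , zero)     (b , suc zero) = swap a b
    transitive (a , suc zero) (b , zero)     with swap b a
    ... | τ , τb≡a = τ ⁻¹ᴬ , trans (cong (app⁻¹ τ) (sym τb≡a)) (app⁻¹-app τ (b , zero))

  module Intransitive (intransitive : ¬ VertexTransitive) where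

    layer-preserved : ∀ σ v → proj₂ (app σ v) ≡ proj₂ v
    layer-preserved σ (x , zero)     with app σ (x , zero) in σx
    ... | y , zero     = refl
    ... | y , suc zero = ⊥-elim (intransitive (layerSwap⇒vertexTransitive σ σx))
    layer-preserved σ (x , suc zero) with app σ (x , suc zero) in σx
    ... | y , suc zero = refl
    ... | y , zero     = ⊥-elim (intransitive (layerSwap⇒vertexTransitive (σ ⁻¹ᴬ)
                           (trans (cong (app⁻¹ σ) (sym σx)) (app⁻¹-app σ (x , suc zero)))))

    blockMap : Automorphism → Carrier → Carrier
    blockMap σ x = proj₁ (app σ (x , zero))

    block-preserved : ∀ σ x i → proj₁ (app σ (x , i)) ≡ blockMap σ x
    block-preserved σ x zero       = refl
    block-preserved σ x (suc zero) = sym (spoke (layer-preserved σ (x , zero))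
                                               (layer-preserved σ (x , suc zero))
                                               (preserves⁺ σ {x , zero} {x , suc zero} refl))
      where
      spoke : ∀ {u v} → proj₂ u ≡ zero → proj₂ v ≡ suc zero → Adj u v → proj₁ u ≡ proj₁ v
      spoke {_ , zero} {_ , suc zero} refl refl u≡v = u≡v

    app≡blockMap : ∀ σ x i → app σ (x , i) ≡ (blockMap σ x , i)
    app≡blockMap σ x i = cong₂ _,_ (block-preserved σ x i) (layer-preserved σ (x , i))

    blockMap-inverseˡ : ∀ σ y → blockMap σ (blockMap (σ ⁻¹ᴬ) y) ≡ y
    blockMap-inverseˡ σ y = trans (cong (λ v → proj₁ (app σ v)) (sym (app≡blockMap (σ ⁻¹ᴬ) y zero)))
                                  (cong proj₁ (app-app⁻¹ σ (y , zero)))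

    blockMap-inverseʳ : ∀ σ x → blockMap (σ ⁻¹ᴬ) (blockMap σ x) ≡ x
    blockMap-inverseʳ σ x = blockMap-inverseˡ (σ ⁻¹ᴬ) x

    blockMap-preserves : ∀ σ {g h} → QAdj g h → QAdj (blockMap σ g) (blockMap σ h)
    blockMap-preserves σ {g} {h} (g≢h , i , j , e) =
        (λ σg≡σh → g≢h (begin
           g                                ≡⟨ sym (blockMap-inverseʳ σ g) ⟩
           blockMap (σ ⁻¹ᴬ) (blockMap σ g)  ≡⟨ cong (blockMap (σ ⁻¹ᴬ)) σg≡σh ⟩
           blockMap (σ ⁻¹ᴬ) (blockMap σ h)  ≡⟨ blockMap-inverseʳ σ h ⟩
           h                                ∎))
      , i , j , subst₂ Adj (app≡blockMap σ g i) (app≡blockMap σ h j) (preserves⁺ σ e)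

    induced : Automorphism → ΓΩ.Automorphism
    induced σ = record
      { perm      = mk↔ₛ′ (blockMap σ) (blockMap (σ ⁻¹ᴬ)) (blockMap-inverseˡ σ) (blockMap-inverseʳ σ)
      ; preserves = λ g h → mk⇔ (blockMap-preserves σ)
          (λ e → subst₂ QAdj (blockMap-inverseʳ σ g) (blockMap-inverseʳ σ h)
                   (blockMap-preserves (σ ⁻¹ᴬ) e))
      }

    autEmbeds : AutEmbeds
    autEmbeds = (λ σ → induced σ , block-preserved σ) , faithful
      where
      faithful : ∀ σ σ' τ → Induces σ τ → Induces σ' τ → ∀ v → app σ v ≡ app σ' v
      faithful σ σ' τ σ↦τ σ'↦τ (x , i) =
        trans (cong₂ _,_ (σ↦τ x i) (layer-preserved σ (x , i)))
              (sym (cong₂ _,_ (σ'↦τ x i) (layer-preserved σ' (x , i))))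

    normalCayley⇒normalSemiCayley : NormalCayleyΩ → NormalSemiCayley
    normalCayley⇒normalSemiCayley normal σ g with normal (induced σ) g
    ... | h , conj = h , λ { (x , i) → begin
          app σ (ρ g (app⁻¹ σ (x , i)))             ≡⟨ cong (λ v → app σ (ρ g v)) (app≡blockMap (σ ⁻¹ᴬ) x i) ⟩
          app σ (blockMap (σ ⁻¹ᴬ) x ∙ g , i)          ≡⟨ app≡blockMap σ _ i ⟩
          (blockMap σ (blockMap (σ ⁻¹ᴬ) x ∙ g) , i)  ≡⟨ cong (_, i) (conj x) ⟩
          (x ∙ h , i)                               ∎ }

  module Quotient (ε∉R : ¬ (ε ∈ R)) (ε∉L : ¬ (ε ∈ L)) where

    isCayleyS : IsCayleyS
    isCayleyS g h = mk⇔ to from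
      where
      to : QAdj g h → CayAdj g h
      to (_   , zero     , zero     , e) = ∈-++⁺ˡ e
      to (_   , suc zero , suc zero , e) = ∈-++⁺ʳ R e
      to (g≢h , zero     , suc zero , e) = ⊥-elim (g≢h e)
      to (g≢h , suc zero , zero     , e) = ⊥-elim (g≢h e)
      from : CayAdj g h → QAdj g h
      from c with ∈-++⁻ R c
      ... | inj₁ r = //∈⇒≢ ε∉R r , zero , zero , r
      ... | inj₂ l = //∈⇒≢ ε∉L l , suc zero , suc zero , l

    valency : Unique R → Unique L → (∀ x → x ∈ R → ¬ (x ∈ L)) → Valency (length R + length L)
    valency unique-R unique-L disjoint g =
        map (_∙ g) (R ++ L)
      , Unique.map⁺ (∙-cancelʳ g _ _) (Unique.++⁺ unique-R unique-L (λ (r , l) → disjoint _ r l))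
      , (λ h → mk⇔ (λ m → Equivalence.from (isCayleyS g h) (Equivalence.to (∈-map-∙ʳ (R ++ L)) m))
                   (λ q → Equivalence.from (∈-map-∙ʳ (R ++ L)) (Equivalence.to (isCayleyS g h) q)))
      , trans (length-map _ (R ++ L)) (length-++ R)

lemma3p4 : (G : FinAbGroup) → let open FinAbGroup G in
    (R L : List Carrier) → Unique R → Unique L →
    (∃ λ g → g ≢ ε) →
    (∀ x → x ∈ R → x ⁻¹ ∈ R) → (∀ x → x ∈ L → x ⁻¹ ∈ L) →
    ¬ (ε ∈ R) → ¬ (ε ∈ L) →
    length L ≤ length R → length R ≤ 2 →
    Graph.Connected (SC.Adj G R L) →
    ¬ Graph.VertexTransitive (SC.Adj G R L) →
    (∀ x → x ∈ R → ¬ (x ∈ L)) →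
    SC.Conclusion G R L
lemma3p4 G R L unique-R unique-L _ _ _ ε∉R ε∉L _ _ _ intransitive disjoint =
    autEmbeds , isCayleyS , valency unique-R unique-L disjoint , normalCayley⇒normalSemiCayley
  where
  open SemiCayley G R L
  open Intransitive intransitive
  open Quotient ε∉R ε∉L
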